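{- Let $W_{\Delta,n}$ be a Knödel graph, with vertex set $U\cup V$, $U=\{u_0,\dots,u_{n/2-1}\}$, $V=\{v_0,\dots,v_{n/2-1}\}$, indices taken modulo $n/2$. Let $x_0x_1\cdots x_m$ be any walk of length $m\ge 1$ in $W_{\Delta,n}$, and let $i$ be the index of its first vertex $x_0$ and $j$ the index of its last vertex $x_m$ (i.e. $x_0\in\{u_i,v_i\}$, $x_m\in\{u_j,v_j\}$). Then there exist $a_1,\dots,a_m\in\mathscr{M}_{\Delta}$ and a sign $\varepsilon\in\{+1,-1\}$ such that \[ j-i\equiv \varepsilon\sum_{k=1}^{m}(-1)^{k-1}a_k \pmod{n/2}.\]
   Context: Knödel graph: for an even integer $n$ and an integer $\Delta$ with $1\le\Delta\le\lfloor\log_2 n\rfloor$, $W_{\Delta,n}$ is the simple bipartite graph with vertex set $U\cup V$, where $U=\{u_0,\dots,u_{n/2-1}\}$ and $V=\{v_0,\dots,v_{n/2-1}\}$; all indices are read modulo $n/2$ (so $u_i=u_{i'}$ iff $i\equiv i'\pmod{n/2}$, similarly for $v$). The vertices $u_i$ and $v_j$ are adjacent iff $j-i\equiv 2^k-1\pmod{n/2}$ for some $k\in\{0,1,\dots,\Delta-1\}$; there are no edges inside $U$ or inside $V$. Notation: $\mathscr{M}_{\Delta}=\{2^0-1,2^1-1,\dots,2^{\Delta-1}-1\}$. A walk of length $m$ is a sequence $x_0x_1\cdots x_m$ of vertices with consecutive ones adjacent. -}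

module Defs where

open import Data.Nat as ℕ using (ℕ; zero; suc; _^_)
open import Data.Integer as ℤ using (ℤ; +_; _-_; _+_; _*_; -_; 1ℤ)
open import Data.Integer.Divisibility using (_∣_)
open import Data.Fin as Fin using (Fin; toℕ; inject₁)
open import Data.Empty using (⊥)
open import Data.Vec using (Vec; lookup)
open import Data.Product using (Σ; ∃; _×_; _,_)
open import Data.Sum using (_⊎_)
open import Relation.Binary.PropositionalEquality using (_≡_)

infix 4 _≡ᵐ_[mod_]

_≡ᵐ_[mod_] : ℤ → ℤ → ℕ → Set
a ≡ᵐ b [mod h ] = (+ h) ∣ (a - b)

data Side : Set where
  U V : Side

-- Vertices of W_{Δ,n} with h = n/2: u_i = (U , i), v_i = (V , i), i ∈ {0,…,h-1}.
Vertex : ℕ → Set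
Vertex h = Side × Fin h

idx : ∀ {h} → Vertex h → ℤ
idx (_ , i) = + toℕ i

InM : ℕ → ℤ → Set
InM Δ a = Σ ℕ λ k → (k ℕ.< Δ) × (a ≡ (+ (2 ^ k)) - 1ℤ)

UVAdj : (h Δ : ℕ) → Fin h → Fin h → Set
UVAdj h Δ i j = Σ ℕ λ k → (k ℕ.< Δ) × ((+ toℕ j) - (+ toℕ i) ≡ᵐ (+ (2 ^ k)) - 1ℤ [mod h ])

Adj : (h Δ : ℕ) → Vertex h → Vertex h → Set
Adj h Δ (U , i) (U , j) = ⊥
Adj h Δ (U , i) (V , j) = UVAdj h Δ i j
Adj h Δ (V , i) (U , j) = UVAdj h Δ j i
Adj h Δ (V , i) (V , j) = ⊥

IsWalk : (h Δ m : ℕ) → Vec (Vertex h) (suc m) → Set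
IsWalk h Δ m xs = (k : Fin m) →
  Adj h Δ (lookup xs (inject₁ k)) (lookup xs (Fin.suc k))

-- alternating sum  Σ_{k=1}^{m} (-1)^{k-1} a_k, with a_k = a (k-1) for k-1 : Fin m
altSum : (m : ℕ) → (Fin m → ℤ) → ℤ
altSum zero a = + 0
altSum (suc m) a = a Fin.zero - altSum m (λ k → a (Fin.suc k))

module Submission where

-- Give each side of the bipartition a sign: σ(U) = +1 and
-- σ(V) = -1.  A single edge x → y changes the index by a member of 𝓜_Δ,
-- counted with the sign of the side it leaves:
--     idx y - idx x ≡ σ(x) · a   (mod h),   a ∈ 𝓜_Δ,
-- and it always switches sides, so σ(y) = - σ(x).  Summing these steps
-- along a walk x₀ x₁ ⋯ x_m, the signs alternate, and by induction on m
--     idx x_m - idx x₀ ≡ σ(x₀) · Σ_{k=1}^{m} (-1)^{k-1} a_k   (mod h).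
-- The theorem follows with ε = σ(x₀).

open import Defs
open import Data.Nat using (ℕ; suc; _≤_; _^_; _*_)
open import Data.Integer using (ℤ; +_; _-_; -_; _+_; 1ℤ) renaming (_*_ to _ℤ*_)
open import Data.Integer.Properties using (*-identityˡ)
open import Data.Integer.Divisibility.Signed
  using (∣ᵤ⇒∣; ∣⇒∣ᵤ; ∣m∣n⇒∣m+n; ∣n⇒∣m*n; ∣-refl) renaming (_∣_ to _∣ₛ_)
open import Data.Integer.Tactic.RingSolver using (solve-∀)
open import Data.Fin using (Fin; fromℕ; zero; suc; toℕ)
open import Data.Vec using (Vec; lookup; _∷_; [])
open import Data.Vec.Functional using () renaming (_∷_ to _∷ᶠ_)
open import Data.Product using (Σ; _×_; _,_)
open import Data.Sum using (_⊎_; inj₁; inj₂)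
open import Relation.Binary.PropositionalEquality using (_≡_; refl; sym; cong; subst₂)

≡ᵐ-refl : ∀ {h} (a : ℤ) → a ≡ᵐ a [mod h ]
≡ᵐ-refl {h} a = ∣⇒∣ᵤ {+ h} {a - a} (subst₂ _∣ₛ_ refl (vanish (+ h) a) (∣n⇒∣m*n (+ 0) ∣-refl))
  where
  vanish : ∀ (h a : ℤ) → + 0 ℤ* h ≡ a - a
  vanish = solve-∀

≡ᵐ-cong : ∀ {h a a′ b b′} → a ≡ a′ → b ≡ b′ →
  a ≡ᵐ b [mod h ] → a′ ≡ᵐ b′ [mod h ]
≡ᵐ-cong refl refl c = c

≡ᵐ-+ : ∀ {h a b c d} → a ≡ᵐ b [mod h ] → c ≡ᵐ d [mod h ] →
  a + c ≡ᵐ b + d [mod h ]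
≡ᵐ-+ {h} {a} {b} {c} {d} ab cd =
  ∣⇒∣ᵤ {+ h} {(a + c) - (b + d)} (subst₂ _∣ₛ_ refl (regroup a b c d)
    (∣m∣n⇒∣m+n (∣ᵤ⇒∣ {+ h} {a - b} ab) (∣ᵤ⇒∣ {+ h} {c - d} cd)))
  where
  regroup : ∀ (a b c d : ℤ) → (a - b) + (c - d) ≡ (a + c) - (b + d)
  regroup = solve-∀

≡ᵐ-scale : ∀ {h a b} (e : ℤ) → a ≡ᵐ b [mod h ] → e ℤ* a ≡ᵐ e ℤ* b [mod h ]
≡ᵐ-scale {h} {a} {b} e ab =
  ∣⇒∣ᵤ {+ h} {e ℤ* a - e ℤ* b} (subst₂ _∣ₛ_ refl (distrib e a b)
    (∣n⇒∣m*n e (∣ᵤ⇒∣ {+ h} {a - b} ab)))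
  where
  distrib : ∀ (e a b : ℤ) → e ℤ* (a - b) ≡ e ℤ* a - e ℤ* b
  distrib = solve-∀

-- σ(U) = +1, σ(V) = -1: the direction in which an edge leaving that side
-- moves the index.
sgn : Side → ℤ
sgn U = + 1
sgn V = - (+ 1)

sgn-unit : ∀ s → sgn s ≡ + 1 ⊎ sgn s ≡ - (+ 1)
sgn-unit U = inj₁ refl
sgn-unit V = inj₂ refl

side : ∀ {h} → Vertex h → Side
side (s , _) = s

edgeStep : ∀ {h Δ} (x y : Vertex h) → Adj h Δ x y →
  Σ ℤ λ a → InM Δ a ×
    (idx y - idx x ≡ᵐ sgn (side x) ℤ* a [mod h ]) ×
    (sgn (side y) ≡ - sgn (side x))
edgeStep (U , i) (U , j) ()
edgeStep (V , i) (V , j) ()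
edgeStep (U , i) (V , j) (k , k<Δ , j-i≡a) =
  + 2 ^ k - 1ℤ , (k , k<Δ , refl) ,
  ≡ᵐ-cong {a = + toℕ j - + toℕ i} refl (sym (*-identityˡ (+ 2 ^ k - 1ℤ))) j-i≡a ,
  refl
edgeStep {h} (V , i) (U , j) (k , k<Δ , i-j≡a) =
  + 2 ^ k - 1ℤ , (k , k<Δ , refl) ,
  ≡ᵐ-cong {b = - (+ 1) ℤ* (+ 2 ^ k - 1ℤ)} (negate (+ toℕ i) (+ toℕ j)) refl
    (≡ᵐ-scale {h} {+ toℕ i - + toℕ j} (- (+ 1)) i-j≡a) ,
  refl
  where
  negate : ∀ (i j : ℤ) → - (+ 1) ℤ* (i - j) ≡ j - i
  negate = solve-∀

-- The first edge contributes σ(x₀)·a₁; the rest of the walk starts on the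
-- other side, so its alternating sum enters with the opposite sign.
walkDisplacement : ∀ {h Δ} (m : ℕ) (xs : Vec (Vertex h) (suc m)) → IsWalk h Δ m xs →
  Σ (Fin m → ℤ) λ a → ((k : Fin m) → InM Δ (a k)) ×
    (idx (lookup xs (fromℕ m)) - idx (lookup xs zero)
       ≡ᵐ sgn (side (lookup xs zero)) ℤ* altSum m a [mod h ])
walkDisplacement 0 (x ∷ []) _ =
  (λ ()) , (λ ()) , ≡ᵐ-cong (sym (self-diff (idx x))) (sym (scaled-zero (sgn (side x)))) (≡ᵐ-refl (+ 0))
  where
  self-diff : ∀ (x : ℤ) → x - x ≡ + 0
  self-diff = solve-∀
  scaled-zero : ∀ (e : ℤ) → e ℤ* + 0 ≡ + 0
  scaled-zero = solve-∀
walkDisplacement {h} {Δ} (suc m) (x ∷ y ∷ ys) walk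
  with edgeStep x y (walk zero) | walkDisplacement m (y ∷ ys) (λ k → walk (suc k))
... | a₀ , a₀∈M , first , σy≡-σx | a , a∈M , rest =
  a₀ ∷ᶠ a , prepend∈M ,
  ≡ᵐ-cong (telescope (idx x) (idx y) last) (combine σx a₀ S)
    (≡ᵐ-+ {a = idx y - idx x} {σx ℤ* a₀} {last - idx y} {(- σx) ℤ* S} first rest′)
  where
  σx = sgn (side x)
  S = altSum m a
  last = idx (lookup (y ∷ ys) (fromℕ m))
  rest′ : last - idx y ≡ᵐ (- σx) ℤ* S [mod h ]
  rest′ = ≡ᵐ-cong {a = last - idx y} refl (cong (_ℤ* S) σy≡-σx) rest
  prepend∈M : (k : Fin (suc m)) → InM Δ ((a₀ ∷ᶠ a) k)
  prepend∈M zero = a₀∈M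
  prepend∈M (suc k) = a∈M k
  telescope : ∀ (x y z : ℤ) → (y - x) + (z - y) ≡ z - x
  telescope = solve-∀
  combine : ∀ (e a S : ℤ) → e ℤ* a + (- e) ℤ* S ≡ e ℤ* (a - S)
  combine = solve-∀

mainTheorem1 : (h Δ : ℕ) → 1 ≤ h → 1 ≤ Δ → 2 ^ Δ ≤ 2 * h →
    (m : ℕ) → 1 ≤ m → (xs : Vec (Vertex h) (suc m)) → IsWalk h Δ m xs →
    Σ (Fin m → ℤ) λ a → ((k : Fin m) → InM Δ (a k)) ×
      (Σ ℤ λ ε → (ε ≡ + 1 ⊎ ε ≡ - (+ 1)) ×
        (idx (lookup xs (fromℕ m)) - idx (lookup xs zero) ≡ᵐ ε ℤ* altSum m a [mod h ]))
mainTheorem1 h Δ _ _ _ m _ xs walk with walkDisplacement m xs walk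
... | a , a∈M , displacement =
  a , a∈M , sgn (side (lookup xs zero)) , sgn-unit (side (lookup xs zero)) , displacement
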